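{- Let $n, m \geq 1$, let $M(x) \in M_{n \times m}(\mathbb{Z}[x])$ be an $n\times m$ matrix with polynomial entries, and let $\mathbf{m} \in \mathbb{Z}^n \setminus \{0\}$ be such that the $m$ entries of the row vector $\mathbf{m}^t(M(x) - M(0))$ are linearly independent over $\mathbb{Z}$. Then the vector $\mathbf{m}^t M(x) \in (\mathbb{Z}[x])^m$ has multiplicative complexity $Q$, where \[ Q = Q(M(x), \mathbf{m}) = m!\, \big(n\|M(x) - M(0)\|\, \|\mathbf{m}\|_\infty\big)^m. \]
   Context: A vector $P(x) = [P_1(x), \dots, P_r(x)] \in (\mathbb{Z}[x])^r$ has multiplicative complexity $Q$ if for all $a = (a_1, \dots, a_r) \in \mathbb{Z}^r$ and $q \in \mathbb{Z}$ with $\gcd(a_1, \dots, a_r, q) = 1$, writing $(P(x) - P(0)) \cdot a = \sum_{j = 1}^{D} b_jx^j$, we have $\gcd(b_1, \dots, b_D, q) \leq Q$. Here $\|M(x) - M(0)\|$ denotes the largest (absolute value of a) polynomial coefficient occurring in any entry of $M(x) - M(0)$, and $\|\mathbf{m}\|_\infty$ is the maximum absolute value of the coordinates of $\mathbf{m}$. Note $m$ (plain) denotes the number of columns and $\mathbf{m}$ (bold) the integer vector. -}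

module Defs where

open import Data.Nat as ℕ using (ℕ; zero; suc; _⊔_)
open import Data.Nat.GCD using (gcd)
open import Data.Integer as ℤ using (ℤ; ∣_∣)
open import Data.Fin using (Fin; zero; suc)
open import Relation.Binary.PropositionalEquality using (_≡_)

sumFin : ∀ {k} → (Fin k → ℤ) → ℤ
sumFin {zero}  f = ℤ.+ 0
sumFin {suc k} f = f zero ℤ.+ sumFin (λ i → f (suc i))

maxFin : ∀ {k} → (Fin k → ℕ) → ℕ
maxFin {zero}  f = 0
maxFin {suc k} f = f zero ⊔ maxFin (λ i → f (suc i))

gcdFin : ∀ {k} → (Fin k → ℤ) → ℕ
gcdFin {zero}  f = 0
gcdFin {suc k} f = gcd ∣ f zero ∣ (gcdFin (λ i → f (suc i)))

-- A polynomial in ℤ[x] of degree ≤ D is given by its coefficient function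
-- Fin (suc D) → ℤ; index j is the coefficient of x^j.
Poly : ℕ → Set
Poly D = Fin (suc D) → ℤ

-- Multiplicative complexity Q of a vector P = [P_1,…,P_r] of polynomials
-- (all of degree ≤ D): for all a ∈ ℤ^r, q ∈ ℤ with gcd(a_1,…,a_r,q) = 1,
-- writing (P(x) - P(0))·a = Σ_{j=1}^{D} b_j x^j, gcd(b_1,…,b_D,q) ≤ Q.
-- Coefficient b_{k+1} is indexed by k : Fin D.
MultComplexity : ∀ {r D} → (Fin r → Poly D) → ℕ → Set
MultComplexity {r} {D} P Q =
  (a : Fin r → ℤ) (q : ℤ) →
  gcd (gcdFin a) ∣ q ∣ ≡ 1 →
  gcd (gcdFin (λ (k : Fin D) → sumFin (λ l → a l ℤ.* P l (suc k)))) ∣ q ∣ ℕ.≤ Q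

PolyMat : ℕ → ℕ → ℕ → Set
PolyMat n m D = Fin n → Fin m → Poly D

rowTimes : ∀ {n m D} → (Fin n → ℤ) → PolyMat n m D → Fin m → Poly D
rowTimes v M j c = sumFin (λ i → v i ℤ.* M i j c)

rowTimesNoConst : ∀ {n m D} → (Fin n → ℤ) → PolyMat n m D → Fin m → Poly D
rowTimesNoConst v M j zero    = ℤ.+ 0
rowTimesNoConst v M j (suc c) = rowTimes v M j (suc c)

LinIndep : ∀ {m D} → (Fin m → Poly D) → Set
LinIndep {m} {D} p =
  (c : Fin m → ℤ) →
  ((k : Fin (suc D)) → sumFin (λ j → c j ℤ.* p j k) ≡ ℤ.+ 0) →
  (j : Fin m) → c j ≡ ℤ.+ 0

normNoConst : ∀ {n m D} → PolyMat n m D → ℕ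
normNoConst M = maxFin (λ i → maxFin (λ j → maxFin (λ k → ∣ M i j (suc k) ∣)))

supNorm : ∀ {n} → (Fin n → ℤ) → ℕ
supNorm v = maxFin (λ i → ∣ v i ∣)

{-# OPTIONS --safe #-}
module Submission where

-- The non-constant coefficient vectors p₁, …, pₘ ∈ ℤᴰ of the entries of 𝐦ᵗ M(x) are
-- linearly independent, so some m × m minor Δ of the matrix with rows pₗ is nonzero.
-- Write bₖ = Σₗ aₗ pₗₖ. By Cramer's rule aₗ Δ is the minor obtained by replacing the
-- row pₗ with b, so every common divisor g of the bₖ and q divides aₗ Δ for all l and
-- q Δ; as gcd(a, q) = 1 it divides Δ. Hence g ≤ |Δ| ≤ m! Bᵐ, where B = n ‖M − M(0)‖ ‖𝐦‖∞
-- bounds the entries pₗₖ.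

module MaximalMinors where

  open import Defs
  open import Data.Empty using (⊥-elim)
  open import Data.Fin using (Fin; zero; suc)
  open import Data.Fin.Properties using (all?; ¬∀⟶∃¬; punchInᵢ≢i)
  open import Data.Integer as ℤ using (ℤ; _+_; _*_; _-_; -_; ∣_∣; 0ℤ; 1ℤ; _≟_)
  open import Data.Integer.Divisibility.Signed using (_∣_; divides; quotient; ∣ᵤ⇒∣; ∣⇒∣ᵤ)
  import Data.Integer.Properties as ℤP
  open import Algebra.Properties.CommutativeMonoid.Sum ℤP.+-0-commutativeMonoid
    using (sum; sum-cong-≗; sum-remove; sum-replicate-zero)
  open import Data.Integer.Tactic.RingSolver using (solve-∀)
  open import Data.List using (List; []; _∷_; length)
  open import Data.Nat as ℕ using (ℕ; zero; suc; _≤_; z≤n; _!; _^_; ≢-nonZero)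
  import Data.Nat.Divisibility as ℕ
  open import Data.Nat.GCD using (gcd; gcd[m,n]∣m; gcd[m,n]∣n; gcd-greatest; c*gcd[m,n]≡gcd[cm,cn])
  import Data.Nat.Properties as ℕP
  import Data.Nat.Tactic.RingSolver as ℕ-Solver
  open import Data.Product using (∃; _×_; _,_)
  open import Data.Vec.Functional using (Vector; head; tail; updateAt; removeAt)
  open import Data.Vec.Functional.Properties
    using (updateAt-updates; updateAt-minimal; updateAt-id-local)
  open import Function using (_∘_; const)
  open import Relation.Binary.PropositionalEquality
  open import Relation.Nullary using (yes; no)

  private
    variable
      D m r : ℕ

  sumFin≡sum : (f : Fin r → ℤ) → sumFin f ≡ sum f
  sumFin≡sum {zero}  f = refl
  sumFin≡sum {suc r} f = cong (f zero +_) (sumFin≡sum (f ∘ suc))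

  sumFin-cong : {f g : Fin r → ℤ} → f ≗ g → sumFin f ≡ sumFin g
  sumFin-cong {f = f} {g} f≗g = begin
    sumFin f ≡⟨ sumFin≡sum f ⟩
    sum f    ≡⟨ sum-cong-≗ f≗g ⟩
    sum g    ≡⟨ sumFin≡sum g ⟨
    sumFin g ∎
    where open ≡-Reasoning

  sumFin-zero : {f : Fin r → ℤ} → f ≗ const 0ℤ → sumFin f ≡ 0ℤ
  sumFin-zero {r} f≗0 =
    trans (sumFin-cong f≗0) (trans (sumFin≡sum {r} (const 0ℤ)) (sum-replicate-zero r))

  sumFin-single : (f : Fin r → ℤ) (l : Fin r) → (∀ j → j ≢ l → f j ≡ 0ℤ) → sumFin f ≡ f l
  sumFin-single {suc r} f l f≡0 = begin
    sumFin f                    ≡⟨ sumFin≡sum f ⟩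
    sum f                       ≡⟨ sum-remove f ⟩
    f l + sum (removeAt f l)    ≡⟨ cong (f l +_) (sumFin≡sum (removeAt f l)) ⟨
    f l + sumFin (removeAt f l) ≡⟨ cong (f l +_) (sumFin-zero (λ j → f≡0 _ (punchInᵢ≢i l j))) ⟩
    f l + 0ℤ                    ≡⟨ ℤP.+-identityʳ (f l) ⟩
    f l                         ∎
    where open ≡-Reasoning

  neg-sumFin : (f : Fin r → ℤ) → - sumFin f ≡ sumFin (λ j → - f j)
  neg-sumFin {zero}  f = refl
  neg-sumFin {suc r} f =
    trans (ℤP.neg-distrib-+ (f zero) _) (cong (- f zero +_) (neg-sumFin (f ∘ suc)))

  ∣sumFin∣≤ : (f : Fin r → ℤ) {C : ℕ} → (∀ j → ∣ f j ∣ ≤ C) → ∣ sumFin f ∣ ≤ r ℕ.* C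
  ∣sumFin∣≤ {zero}  f ∣f∣≤C = z≤n
  ∣sumFin∣≤ {suc r} f ∣f∣≤C = ℕP.≤-trans (ℤP.∣i+j∣≤∣i∣+∣j∣ (f zero) _)
    (ℕP.+-mono-≤ (∣f∣≤C zero) (∣sumFin∣≤ (f ∘ suc) (∣f∣≤C ∘ suc)))

  Form : ℕ → Set
  Form D = List (Fin D) → ℤ

  -- (x ∧ H) T = Σᵢ (-1)ⁱ x(Tᵢ) H(T without Tᵢ): the exterior product of the linear form x
  -- with the alternating form H, evaluated on the list of columns T.
  infixr 5 _∧_
  _∧_ : Vector ℤ D → Form D → Form D
  (x ∧ H) []      = 0ℤ
  (x ∧ H) (t ∷ T) = x t * H T - (x ∧ H ∘ (t ∷_)) T

  module _ {x y : Vector ℤ D} where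

    ∧-cong : {H K : Form D} → x ≗ y → H ≗ K → x ∧ H ≗ y ∧ K
    ∧-cong x≗y H≗K []      = refl
    ∧-cong x≗y H≗K (t ∷ T) = cong₂ _-_ (cong₂ _*_ (x≗y t) (H≗K T)) (∧-cong x≗y (H≗K ∘ (t ∷_)) T)

    ∧-distribʳ-+ : (H : Form D) → (λ k → x k + y k) ∧ H ≗ λ T → (x ∧ H) T + (y ∧ H) T
    ∧-distribʳ-+ H []      = refl
    ∧-distribʳ-+ H (t ∷ T) =
      trans (cong (_-_ ((x t + y t) * H T)) (∧-distribʳ-+ (H ∘ (t ∷_)) T))
            (regroup (x t) (y t) (H T) _ _)
      where regroup : ∀ a b h e f → (a + b) * h - (e + f) ≡ (a * h - e) + (b * h - f)
            regroup = solve-∀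

  module _ (x : Vector ℤ D) where

    ∧-zeroˡ : (H : Form D) → x ≗ const 0ℤ → x ∧ H ≗ const 0ℤ
    ∧-zeroˡ H x≗0 []      = refl
    ∧-zeroˡ H x≗0 (t ∷ T) rewrite x≗0 t | ∧-zeroˡ (H ∘ (t ∷_)) x≗0 T = refl

    ∧-zeroʳ : {H : Form D} → H ≗ const 0ℤ → x ∧ H ≗ const 0ℤ
    ∧-zeroʳ H≗0 []      = refl
    ∧-zeroʳ H≗0 (t ∷ T) rewrite H≗0 T | ∧-zeroʳ (H≗0 ∘ (t ∷_)) T | ℤP.*-zeroʳ (x t) = refl

    ∧-scaleˡ : (c : ℤ) (H : Form D) → (λ k → c * x k) ∧ H ≗ λ T → c * (x ∧ H) T
    ∧-scaleˡ c H []      = sym (ℤP.*-zeroʳ c)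
    ∧-scaleˡ c H (t ∷ T) =
      trans (cong (_-_ ((c * x t) * H T)) (∧-scaleˡ c (H ∘ (t ∷_)) T)) (factor c (x t) (H T) _)
      where factor : ∀ c a h e → (c * a) * h - c * e ≡ c * (a * h - e)
            factor = solve-∀

    ∧-scaleʳ : (c : ℤ) (H : Form D) → x ∧ (λ R → c * H R) ≗ λ T → c * (x ∧ H) T
    ∧-scaleʳ c H []      = sym (ℤP.*-zeroʳ c)
    ∧-scaleʳ c H (t ∷ T) =
      trans (cong (_-_ (x t * (c * H T))) (∧-scaleʳ c (H ∘ (t ∷_)) T)) (factor c (x t) (H T) _)
      where factor : ∀ c a h e → a * (c * h) - c * e ≡ c * (a * h - e)
            factor = solve-∀

    ∧-distribˡ-+ : (H K : Form D) → x ∧ (λ R → H R + K R) ≗ λ T → (x ∧ H) T + (x ∧ K) T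
    ∧-distribˡ-+ H K []      = refl
    ∧-distribˡ-+ H K (t ∷ T) =
      trans (cong (_-_ (x t * (H T + K T))) (∧-distribˡ-+ (H ∘ (t ∷_)) (K ∘ (t ∷_)) T))
            (regroup (x t) (H T) (K T) _ _)
      where regroup : ∀ a h k e f → a * (h + k) - (e + f) ≡ (a * h - e) + (a * k - f)
            regroup = solve-∀

    ∧-distribˡ-- : (H K : Form D) → x ∧ (λ R → H R - K R) ≗ λ T → (x ∧ H) T - (x ∧ K) T
    ∧-distribˡ-- H K []      = refl
    ∧-distribˡ-- H K (t ∷ T) =
      trans (cong (_-_ (x t * (H T - K T))) (∧-distribˡ-- (H ∘ (t ∷_)) (K ∘ (t ∷_)) T))
            (regroup (x t) (H T) (K T) _ _)
      where regroup : ∀ a h k e f → a * (h - k) - (e - f) ≡ (a * h - e) - (a * k - f)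
            regroup = solve-∀

    ∧-sumFin : (c : Fin r → ℤ) (G : Fin r → Form D) →
               x ∧ (λ R → sumFin (λ l → c l * G l R)) ≗ λ T → sumFin (λ l → c l * (x ∧ G l) T)
    ∧-sumFin {zero}  c G = ∧-zeroʳ (λ _ → refl)
    ∧-sumFin {suc r} c G T = begin
      (x ∧ (λ R → c zero * G zero R + sumFin (λ l → c (suc l) * G (suc l) R))) T
        ≡⟨ ∧-distribˡ-+ _ _ T ⟩
      (x ∧ (λ R → c zero * G zero R)) T + (x ∧ (λ R → sumFin (λ l → c (suc l) * G (suc l) R))) T
        ≡⟨ cong₂ _+_ (∧-scaleʳ (c zero) (G zero) T) (∧-sumFin (c ∘ suc) (G ∘ suc) T) ⟩
      c zero * (x ∧ G zero) T + sumFin (λ l → c (suc l) * (x ∧ G (suc l)) T) ∎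
      where open ≡-Reasoning

  ∧-∧-∷ : (x y : Vector ℤ D) (H : Form D) (t : Fin D) (T : List (Fin D)) →
          (x ∧ y ∧ H) (t ∷ T) ≡ x t * (y ∧ H) T - (y t * (x ∧ H) T - (x ∧ y ∧ H ∘ (t ∷_)) T)
  ∧-∧-∷ x y H t T = cong (_-_ (x t * (y ∧ H) T))
    (trans (∧-distribˡ-- x (λ R → y t * H R) (y ∧ H ∘ (t ∷_)) T)
           (cong (_- (x ∧ y ∧ H ∘ (t ∷_)) T) (∧-scaleʳ x (y t) H T)))

  ∧-anticomm : (x y : Vector ℤ D) (H : Form D) → ∀ T → (x ∧ y ∧ H) T + (y ∧ x ∧ H) T ≡ 0ℤ
  ∧-anticomm x y H []      = refl
  ∧-anticomm x y H (t ∷ T) = begin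
    (x ∧ y ∧ H) (t ∷ T) + (y ∧ x ∧ H) (t ∷ T)
      ≡⟨ cong₂ _+_ (∧-∧-∷ x y H t T) (∧-∧-∷ y x H t T) ⟩
    (x t * Y - (y t * X - A)) + (y t * X - (x t * Y - B))
      ≡⟨ cancel (x t * Y) (y t * X) A B ⟩
    A + B
      ≡⟨ ∧-anticomm x y (H ∘ (t ∷_)) T ⟩
    0ℤ ∎
    where
    open ≡-Reasoning
    X Y A B : ℤ
    X = (x ∧ H) T
    Y = (y ∧ H) T
    A = (x ∧ y ∧ H ∘ (t ∷_)) T
    B = (y ∧ x ∧ H ∘ (t ∷_)) T
    cancel : ∀ u v a b → (u - (v - a)) + (v - (u - b)) ≡ a + b
    cancel = solve-∀

  ∧-self : (x : Vector ℤ D) (H : Form D) → x ∧ x ∧ H ≗ const 0ℤ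
  ∧-self x H []      = refl
  ∧-self x H (t ∷ T) =
    trans (∧-∧-∷ x x H t T) (trans (cancel (x t * (x ∧ H) T) _) (∧-self x (H ∘ (t ∷_)) T))
    where cancel : ∀ u a → u - (u - a) ≡ a
          cancel = solve-∀

  -- minor p T is the determinant of the submatrix of p on the columns T (for length T = m).
  minor : (Fin m → Vector ℤ D) → Form D
  minor {zero}  p []      = 1ℤ
  minor {zero}  p (_ ∷ _) = 0ℤ
  minor {suc m} p         = head p ∧ minor (tail p)

  minor-cong : {p q : Fin m → Vector ℤ D} → (∀ i → p i ≗ q i) → minor p ≗ minor q
  minor-cong {zero}  p≗q []      = refl
  minor-cong {zero}  p≗q (_ ∷ _) = refl
  minor-cong {suc m} p≗q         = ∧-cong (p≗q zero) (minor-cong (p≗q ∘ suc))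

  ∧-minor-repeated : (x : Vector ℤ D) (q : Fin m → Vector ℤ D) (w : Fin m) → x ≗ q w →
                     x ∧ minor q ≗ const 0ℤ
  ∧-minor-repeated x q zero    x≗q₀ T =
    trans (∧-cong (λ _ → refl) (∧-cong (sym ∘ x≗q₀) (λ _ → refl)) T) (∧-self x (minor (tail q)) T)
  ∧-minor-repeated {D = D} x q (suc w) x≗qw T = begin
    (x ∧ q₀ ∧ M) T                  ≡⟨ ℤP.+-identityʳ _ ⟨
    (x ∧ q₀ ∧ M) T + 0ℤ             ≡⟨ cong ((x ∧ q₀ ∧ M) T +_) q₀∧x∧M≡0 ⟨
    (x ∧ q₀ ∧ M) T + (q₀ ∧ x ∧ M) T ≡⟨ ∧-anticomm x q₀ M T ⟩
    0ℤ                              ∎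
    where
    open ≡-Reasoning
    q₀ : Vector ℤ D
    q₀ = head q
    M : Form D
    M = minor (tail q)
    q₀∧x∧M≡0 : (q₀ ∧ x ∧ M) T ≡ 0ℤ
    q₀∧x∧M≡0 = ∧-zeroʳ q₀ (∧-minor-repeated x (tail q) w x≗qw) T

  minor-repeated : (p : Fin m → Vector ℤ D) {u w : Fin m} → u ≢ w → p u ≗ p w → minor p ≗ const 0ℤ
  minor-repeated p {zero}  {zero}  u≢w _ = ⊥-elim (u≢w refl)
  minor-repeated p {zero}  {suc w} _   p₀≗pw = ∧-minor-repeated (head p) (tail p) w p₀≗pw
  minor-repeated p {suc u} {zero}  _   pu≗p₀ = ∧-minor-repeated (head p) (tail p) u (sym ∘ pu≗p₀)
  minor-repeated p {suc u} {suc w} u≢w pu≗pw =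
    ∧-zeroʳ (head p) (minor-repeated (tail p) (u≢w ∘ cong suc) pu≗pw)

  infixl 6 _[_]≔_
  _[_]≔_ : {A : Set} → Vector A m → Fin m → A → Vector A m
  p [ l ]≔ y = updateAt p l (const y)

  []≔-cong : (p : Fin m → Vector ℤ D) (l : Fin m) {y z : Vector ℤ D} → y ≗ z →
             ∀ i → (p [ l ]≔ y) i ≗ (p [ l ]≔ z) i
  []≔-cong p zero    y≗z zero    = y≗z
  []≔-cong p zero    y≗z (suc i) = λ _ → refl
  []≔-cong p (suc l) y≗z zero    = λ _ → refl
  []≔-cong p (suc l) y≗z (suc i) = []≔-cong (tail p) l y≗z i

  minor-[]≔-zero : (p : Fin m → Vector ℤ D) (l : Fin m) {y : Vector ℤ D} → y ≗ const 0ℤ →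
                   minor (p [ l ]≔ y) ≗ const 0ℤ
  minor-[]≔-zero p zero    y≗0 = ∧-zeroˡ _ _ y≗0
  minor-[]≔-zero p (suc l) y≗0 = ∧-zeroʳ (head p) (minor-[]≔-zero (tail p) l y≗0)

  minor-[]≔-+ : (p : Fin m → Vector ℤ D) (l : Fin m) (y z : Vector ℤ D) →
                minor (p [ l ]≔ (λ k → y k + z k))
                  ≗ λ T → minor (p [ l ]≔ y) T + minor (p [ l ]≔ z) T
  minor-[]≔-+ p zero    y z = ∧-distribʳ-+ _
  minor-[]≔-+ p (suc l) y z T =
    trans (∧-cong (λ _ → refl) (minor-[]≔-+ (tail p) l y z) T) (∧-distribˡ-+ (head p) _ _ T)

  minor-[]≔-scale : (p : Fin m → Vector ℤ D) (l : Fin m) (c : ℤ) (y : Vector ℤ D) →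
                    minor (p [ l ]≔ (λ k → c * y k)) ≗ λ T → c * minor (p [ l ]≔ y) T
  minor-[]≔-scale p zero    c y = ∧-scaleˡ y c _
  minor-[]≔-scale p (suc l) c y T =
    trans (∧-cong (λ _ → refl) (minor-[]≔-scale (tail p) l c y) T) (∧-scaleʳ (head p) c _ T)

  minor-[]≔-sumFin : (p : Fin m → Vector ℤ D) (l : Fin m) (a : Fin r → ℤ) (y : Fin r → Vector ℤ D) →
                     minor (p [ l ]≔ (λ k → sumFin (λ j → a j * y j k)))
                       ≗ λ T → sumFin (λ j → a j * minor (p [ l ]≔ y j) T)
  minor-[]≔-sumFin {r = zero}  p l a y = minor-[]≔-zero p l (λ _ → refl)
  minor-[]≔-sumFin {r = suc r} p l a y T =
    trans (minor-[]≔-+ p l (λ k → a zero * y zero k) _ T)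
          (cong₂ _+_ (minor-[]≔-scale p l (a zero) (y zero) T)
                     (minor-[]≔-sumFin p l (a ∘ suc) (y ∘ suc) T))

  minor-[]≔-combination : (p : Fin m → Vector ℤ D) (a : Fin m → ℤ) (l : Fin m) →
                          minor (p [ l ]≔ (λ k → sumFin (λ j → a j * p j k)))
                            ≗ λ T → a l * minor p T
  minor-[]≔-combination p a l T = begin
    minor (p [ l ]≔ (λ k → sumFin (λ j → a j * p j k))) T ≡⟨ minor-[]≔-sumFin p l a p T ⟩
    sumFin (λ j → a j * minor (p [ l ]≔ p j) T)         ≡⟨ sumFin-single _ l vanishes ⟩
    a l * minor (p [ l ]≔ p l) T                        ≡⟨ cong (a l *_) (minor-cong unchanged T) ⟩
    a l * minor p T                                     ∎
    where
    open ≡-Reasoning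
    vanishes : ∀ j → j ≢ l → a j * minor (p [ l ]≔ p j) T ≡ 0ℤ
    vanishes j j≢l = trans (cong (a j *_) (minor-repeated (p [ l ]≔ p j) (j≢l ∘ sym) rows-equal T))
                           (ℤP.*-zeroʳ (a j))
      where rows-equal : (p [ l ]≔ p j) l ≗ (p [ l ]≔ p j) j
            rows-equal = cong-app (trans (updateAt-updates l p) (sym (updateAt-minimal j l p j≢l)))
    unchanged : ∀ i → (p [ l ]≔ p l) i ≗ p i
    unchanged i = cong-app (updateAt-id-local l p refl i)

  ∣-minor-[]≔ : (p : Fin m → Vector ℤ D) (l : Fin m) {g : ℤ} {y : Vector ℤ D} → (∀ k → g ∣ y k) →
                ∀ T → g ∣ minor (p [ l ]≔ y) T
  ∣-minor-[]≔ {D = D} p l {g} {y} g∣y T = divides (minor (p [ l ]≔ y′) T) (begin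
    minor (p [ l ]≔ y) T                 ≡⟨ minor-cong ([]≔-cong p l y≗gy′) T ⟩
    minor (p [ l ]≔ (λ k → g * y′ k)) T   ≡⟨ minor-[]≔-scale p l g y′ T ⟩
    g * minor (p [ l ]≔ y′) T             ≡⟨ ℤP.*-comm g _ ⟩
    minor (p [ l ]≔ y′) T * g             ∎)
    where
    open ≡-Reasoning
    y′ : Vector ℤ D
    y′ k = quotient (g∣y k)
    y≗gy′ : y ≗ λ k → g * y′ k
    y≗gy′ k = trans (_∣_.equality (g∣y k)) (ℤP.*-comm (y′ k) g)

  ∣-*-minor : (p : Fin m → Vector ℤ D) (a : Fin m → ℤ) {g : ℤ} →
              (∀ k → g ∣ sumFin (λ j → a j * p j k)) → ∀ l T → g ∣ a l * minor p T
  ∣-*-minor p a g∣b l T = subst (_ ∣_) (minor-[]≔-combination p a l T) (∣-minor-[]≔ p l g∣b T)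

  altSign : Fin r → ℤ
  altSign zero    = 1ℤ
  altSign (suc i) = - altSign i

  minor-cofactor-expansion : (p : Fin (suc m) → Vector ℤ D) (k : Fin D) (R : List (Fin D)) →
    minor p (k ∷ R) ≡ sumFin (λ l → (altSign l * p l k) * minor (removeAt p l) R)
  minor-cofactor-expansion {zero} p k R =
    trans (cong (_-_ (p zero k * minor (tail p) R)) (∧-zeroʳ (head p) (λ _ → refl) R))
          (regroup (p zero k) (minor (tail p) R))
    where regroup : ∀ a u → a * u - 0ℤ ≡ (1ℤ * a) * u + 0ℤ
          regroup = solve-∀
  minor-cofactor-expansion {suc m} p k R = begin
    p zero k * minor (tail p) R - (head p ∧ minor (tail p) ∘ (k ∷_)) R
      ≡⟨ cong (_-_ (p zero k * minor (tail p) R)) (trans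
           (∧-cong (λ _ → refl) (minor-cofactor-expansion (tail p) k) R)
           (∧-sumFin (head p) (λ l → altSign l * p (suc l) k) (minor ∘ removeAt (tail p)) R)) ⟩
    p zero k * minor (tail p) R - S
      ≡⟨ regroup (p zero k) (minor (tail p) R) S ⟩
    (1ℤ * p zero k) * minor (tail p) R + - S
      ≡⟨ cong ((1ℤ * p zero k) * minor (tail p) R +_) (neg-sumFin term) ⟩
    (1ℤ * p zero k) * minor (tail p) R + sumFin (λ l → - term l)
      ≡⟨ cong ((1ℤ * p zero k) * minor (tail p) R +_) (sumFin-cong (λ l →
           trans (ℤP.neg-distribˡ-* (altSign l * p (suc l) k) (N l))
                 (cong (_* N l) (ℤP.neg-distribˡ-* (altSign l) (p (suc l) k))))) ⟩
    sumFin (λ l → (altSign l * p l k) * minor (removeAt p l) R) ∎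
    where
    open ≡-Reasoning
    N : Fin (suc m) → ℤ
    N l = minor (removeAt p (suc l)) R
    term : Fin (suc m) → ℤ
    term l = (altSign l * p (suc l) k) * N l
    S : ℤ
    S = sumFin term
    regroup : ∀ a u s → a * u - s ≡ (1ℤ * a) * u + - s
    regroup = solve-∀

  Independent : (Fin m → Vector ℤ D) → Set
  Independent {m} {D} p =
    (c : Fin m → ℤ) → (∀ k → sumFin (λ j → c j * p j k) ≡ 0ℤ) → ∀ j → c j ≡ 0ℤ

  Independent-tail : (p : Fin (suc m) → Vector ℤ D) → Independent p → Independent (tail p)
  Independent-tail p indep c relation j =
    indep (λ { zero → 0ℤ ; (suc j) → c j }) (λ k → trans (ℤP.+-identityˡ _) (relation k)) (suc j)

  -- Extend a nonvanishing maximal minor Δ of the tail by one column k: if all extensions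
  -- vanished, expanding them along k would give a linear relation with coefficient Δ on p₀.
  nonzero-minor : (p : Fin m → Vector ℤ D) → Independent p →
                  ∃ λ T → length T ≡ m × minor p T ≢ 0ℤ
  nonzero-minor {zero}      p indep = [] , refl , λ ()
  nonzero-minor {suc m} {D} p indep
    with nonzero-minor (tail p) (Independent-tail p indep)
  ... | T , length≡m , Δ≢0 with all? (λ k → minor p (k ∷ T) ≟ 0ℤ)
  ...   | no ¬all0 = let k , Δₖ≢0 = ¬∀⟶∃¬ D _ (λ k → minor p (k ∷ T) ≟ 0ℤ) ¬all0
                     in k ∷ T , cong suc length≡m , Δₖ≢0
  ...   | yes all0 = ⊥-elim (Δ≢0 (trans (sym (ℤP.*-identityˡ _)) (indep cofactor relation zero)))
    where
    cofactor : Fin (suc m) → ℤ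
    cofactor l = altSign l * minor (removeAt p l) T
    relation : ∀ k → sumFin (λ l → cofactor l * p l k) ≡ 0ℤ
    relation k = trans (sumFin-cong (λ l → swap (altSign l) (minor (removeAt p l) T) (p l k)))
                       (trans (sym (minor-cofactor-expansion p k T)) (all0 k))
      where swap : ∀ s u x → (s * u) * x ≡ (s * x) * u
            swap = solve-∀

  ∧-bound : (x : Vector ℤ D) (H : Form D) {B C : ℕ} → (∀ k → ∣ x k ∣ ≤ B) →
            ∀ T → (∀ R → suc (length R) ≡ length T → ∣ H R ∣ ≤ C) →
            ∣ (x ∧ H) T ∣ ≤ length T ℕ.* (B ℕ.* C)
  ∧-bound x H ∣x∣≤B []      ∣H∣≤C = z≤n
  ∧-bound x H ∣x∣≤B (t ∷ T) ∣H∣≤C = ℕP.≤-trans (ℤP.∣i-j∣≤∣i∣+∣j∣ (x t * H T) _) (ℕP.+-mono-≤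
    (ℕP.≤-trans (ℕP.≤-reflexive (ℤP.abs-* (x t) (H T))) (ℕP.*-mono-≤ (∣x∣≤B t) (∣H∣≤C T refl)))
    (∧-bound x (H ∘ (t ∷_)) ∣x∣≤B T (λ R length≡ → ∣H∣≤C (t ∷ R) (cong suc length≡))))

  minor-bound : (p : Fin m → Vector ℤ D) {B : ℕ} → (∀ i k → ∣ p i k ∣ ≤ B) →
                ∀ T → length T ≡ m → ∣ minor p T ∣ ≤ m ! ℕ.* B ^ m
  minor-bound {zero}  p ∣p∣≤B []      _      = ℕP.≤-refl
  minor-bound {suc m} p {B} ∣p∣≤B T length≡m = ℕP.≤-trans
    (∧-bound (head p) (minor (tail p)) (∣p∣≤B zero) T
       (λ R length≡ →
          minor-bound (tail p) (∣p∣≤B ∘ suc) R (ℕP.suc-injective (trans length≡ length≡m))))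
    (ℕP.≤-reflexive (trans (cong (ℕ._* _) length≡m) (regroup (suc m) (m !) B (B ^ m))))
    where regroup : ∀ s f b e → s ℕ.* (b ℕ.* (f ℕ.* e)) ≡ (s ℕ.* f) ℕ.* (b ℕ.* e)
          regroup = ℕ-Solver.solve-∀

  gcdFin-∣ : (f : Fin r → ℤ) (i : Fin r) → gcdFin f ℕ.∣ ∣ f i ∣
  gcdFin-∣ f zero    = gcd[m,n]∣m ∣ f zero ∣ (gcdFin (f ∘ suc))
  gcdFin-∣ f (suc i) = ℕ.∣-trans (gcd[m,n]∣n ∣ f zero ∣ (gcdFin (f ∘ suc))) (gcdFin-∣ (f ∘ suc) i)

  ∣-*gcdFin : (f : Fin r → ℤ) {g c : ℕ} → (∀ i → g ℕ.∣ c ℕ.* ∣ f i ∣) → g ℕ.∣ c ℕ.* gcdFin f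
  ∣-*gcdFin {zero}  f {g} {c} _ rewrite ℕP.*-zeroʳ c = g ℕ.∣0
  ∣-*gcdFin {suc r} f {g} {c} g∣cf rewrite c*gcd[m,n]≡gcd[cm,cn] c ∣ f zero ∣ (gcdFin (f ∘ suc)) =
    gcd-greatest (g∣cf zero) (∣-*gcdFin (f ∘ suc) {g} {c} (g∣cf ∘ suc))

  ∣-of-coprime-multiples : (a : Fin r → ℤ) {q g c : ℕ} → gcd (gcdFin a) q ≡ 1 →
                           (∀ l → g ℕ.∣ c ℕ.* ∣ a l ∣) → g ℕ.∣ c ℕ.* q → g ℕ.∣ c
  ∣-of-coprime-multiples a {q} {g} {c} coprime g∣ca g∣cq = subst (g ℕ.∣_) c*gcd≡c
    (gcd-greatest (∣-*gcdFin a {g} {c} g∣ca) g∣cq)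
    where c*gcd≡c : gcd (c ℕ.* gcdFin a) (c ℕ.* q) ≡ c
          c*gcd≡c = trans (sym (c*gcd[m,n]≡gcd[cm,cn] c (gcdFin a) q))
                          (trans (cong (c ℕ.*_) coprime) (ℕP.*-identityʳ c))

  gcd-∣-minor : (p : Fin m → Vector ℤ D) (a : Fin m → ℤ) (q : ℤ) → gcd (gcdFin a) ∣ q ∣ ≡ 1 →
                ∀ T → gcd (gcdFin (λ k → sumFin (λ l → a l * p l k))) ∣ q ∣ ℕ.∣ ∣ minor p T ∣
  gcd-∣-minor {D = D} p a q coprime T = ∣-of-coprime-multiples a coprime g∣Δa
    (ℕ.∣n⇒∣m*n ∣ minor p T ∣ (gcd[m,n]∣n (gcdFin b) ∣ q ∣))
    where
    b : Fin D → ℤ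
    b k = sumFin (λ l → a l * p l k)
    g : ℕ
    g = gcd (gcdFin b) ∣ q ∣
    g∣b : ∀ k → ℤ.+ g ∣ b k
    g∣b k = ∣ᵤ⇒∣ (ℕ.∣-trans (gcd[m,n]∣m (gcdFin b) ∣ q ∣) (gcdFin-∣ b k))
    g∣Δa : ∀ l → g ℕ.∣ ∣ minor p T ∣ ℕ.* ∣ a l ∣
    g∣Δa l = subst (g ℕ.∣_) (trans (ℤP.abs-* (a l) (minor p T)) (ℕP.*-comm ∣ a l ∣ _))
                   (∣⇒∣ᵤ (∣-*-minor p a g∣b l T))

  ≤-maxFin : (f : Fin r → ℕ) (i : Fin r) → f i ≤ maxFin f
  ≤-maxFin f zero    = ℕP.m≤m⊔n _ _
  ≤-maxFin f (suc i) = ℕP.≤-trans (≤-maxFin (f ∘ suc) i) (ℕP.m≤n⊔m (f zero) _)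

  nonConstCoeffs : {n : ℕ} → (Fin n → ℤ) → PolyMat n m D → Fin m → Vector ℤ D
  nonConstCoeffs v M l k = rowTimes v M l (suc k)

  ∣nonConstCoeffs∣≤ : {n : ℕ} (v : Fin n → ℤ) (M : PolyMat n m D) →
                      ∀ l k → ∣ nonConstCoeffs v M l k ∣ ≤ n ℕ.* normNoConst M ℕ.* supNorm v
  ∣nonConstCoeffs∣≤ {n = n} v M l k =
    ℕP.≤-trans (∣sumFin∣≤ _ ∣vM∣≤NS) (ℕP.≤-reflexive (sym (ℕP.*-assoc n _ _)))
    where
    ∣vM∣≤NS : ∀ i → ∣ v i * M i l (suc k) ∣ ≤ normNoConst M ℕ.* supNorm v
    ∣vM∣≤NS i = ℕP.≤-trans (ℕP.≤-reflexive (trans (ℤP.abs-* (v i) _) (ℕP.*-comm ∣ v i ∣ _)))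
      (ℕP.*-mono-≤
        (ℕP.≤-trans (≤-maxFin _ k) (ℕP.≤-trans (≤-maxFin _ l) (≤-maxFin _ i)))
        (≤-maxFin _ i))

  LinIndep⇒Independent : {n : ℕ} (v : Fin n → ℤ) (M : PolyMat n m D) →
                         LinIndep (rowTimesNoConst v M) → Independent (nonConstCoeffs v M)
  LinIndep⇒Independent v M indep c relation = indep c λ
    { zero    → sumFin-zero (λ j → ℤP.*-zeroʳ (c j))
    ; (suc k) → relation k }

  rowTimes-MultComplexity : {n m D : ℕ} (M : PolyMat n m D) (v : Fin n → ℤ) →
    LinIndep (rowTimesNoConst v M) →
    MultComplexity (rowTimes v M) (m ! ℕ.* (n ℕ.* normNoConst M ℕ.* supNorm v) ^ m)
  rowTimes-MultComplexity M v indep a q coprime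
    with T , length≡m , Δ≢0 ← nonzero-minor (nonConstCoeffs v M) (LinIndep⇒Independent v M indep)
    = ℕP.≤-trans (ℕ.∣⇒≤ ⦃ ≢-nonZero (Δ≢0 ∘ ℤP.∣i∣≡0⇒i≡0) ⦄ (gcd-∣-minor _ a q coprime T))
                 (minor-bound _ (∣nonConstCoeffs∣≤ v M) T length≡m)

open import Defs
open import Data.Nat using (ℕ; _≤_; _*_; _^_; _!)
open import Data.Integer using (ℤ)
open import Data.Fin using (Fin)
open import Relation.Binary.PropositionalEquality using (_≡_)
open import Relation.Nullary using (¬_)
open MaximalMinors using (rowTimes-MultComplexity)

lemma5 : (n m D : ℕ) → 1 ≤ n → 1 ≤ m →
         (M : PolyMat n m D) (v : Fin n → ℤ) →
         ¬ ((i : Fin n) → v i ≡ Data.Integer.+ 0) →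
         LinIndep (rowTimesNoConst v M) →
         MultComplexity (rowTimes v M)
           ((m !) * ((n * normNoConst M * supNorm v) ^ m))
lemma5 n m D _ _ M v _ = rowTimes-MultComplexity M v
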